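{- Let $G$ be a finite abelian group of exponent greater than $2$ with inversion $\iota$. Let $\mathcal{S}_1$ be the set of inverse-closed $S\subseteq G$ with $\mathrm{Cay}(G,S)$ connected, non-bipartite and twin-free, and let \[ \mathcal{S}_3=\{S\in\mathcal{S}_1\mid R(G)\rtimes\langle\iota\rangle<N_{B(S)}(R(G))\},\quad \mathcal{S}_3'=\{S\in\mathcal{S}_1\mid S^\alpha=S \text{ for some } \alpha\in\mathrm{Hol}(G)-\{1,\iota\}\}. \] Then $\mathcal{S}_3\subseteq\mathcal{S}_3'$.
   Context: $\mathrm{Cay}(G,S)$ has vertex set $G$, $x\sim y$ iff $yx^{ -1}\in S$; twin-free means no two distinct vertices have the same neighbourhood. $D(\Gamma)$ is the graph on $V\times\{0,1\}$ with $(u,x)\sim(v,y)$ iff $u\sim v$ and $x\ne y$. $R(g)$ is $x\mapsto xg$, $R(G)=\{R(g)\}$; permutations $\alpha$ of $G$ are identified with $(g,i)\mapsto(g^\alpha,i)$ on $G\times\{0,1\}$. $B(S)$ is the setwise stabilizer of $G\times\{0\}$ in $\mathrm{Aut}(D(\mathrm{Cay}(G,S)))$. $\mathrm{Hol}(G)=N_{\mathrm{Sym}(G)}(R(G))=R(G)\rtimes\mathrm{Aut}(G)$. -}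

module Defs where

open import Level using (0ℓ)
open import Algebra.Bundles using (AbelianGroup)
open import Data.Bool using (Bool; true; false; not)
open import Data.Nat using (ℕ)
open import Data.Fin using (Fin)
open import Data.Product using (Σ; ∃; ∃-syntax; _×_; _,_; proj₁; proj₂)
open import Function.Bundles using (_↔_; _⇔_; Inverse)
open import Relation.Binary.PropositionalEquality using (_≡_; _≢_)
open import Relation.Nullary using (¬_)

module CayleyDefs (G : AbelianGroup 0ℓ 0ℓ) where
  open AbelianGroup G

  EqualityIsPropositional : Set
  EqualityIsPropositional = ∀ x y → x ≈ y → x ≡ y

  IsFinite : Set
  IsFinite = ∃[ n ] (Carrier ↔ Fin n)

  ExponentGreaterThan2 : Set
  ExponentGreaterThan2 = ¬ (∀ x → (x ∙ x) ≡ ε)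

  Subset : Set
  Subset = Carrier → Bool

  InverseClosed : Subset → Set
  InverseClosed S = ∀ x → S (x ⁻¹) ≡ S x

  Adj : Subset → Carrier → Carrier → Set
  Adj S x y = S (y ∙ x ⁻¹) ≡ true

  data Reachable (S : Subset) : Carrier → Carrier → Set where
    here : ∀ {x} → Reachable S x x
    step : ∀ {x y z} → Adj S x y → Reachable S y z → Reachable S x z

  Connected : Subset → Set
  Connected S = ∀ x y → Reachable S x y

  Bipartite : Subset → Set
  Bipartite S = Σ (Carrier → Bool) λ c → ∀ x y → Adj S x y → c x ≢ c y

  TwinFree : Subset → Set
  TwinFree S = ∀ x y → (∀ z → Adj S x z ⇔ Adj S y z) → x ≡ y

  InS1 : Subset → Set
  InS1 S = InverseClosed S × Connected S × ¬ Bipartite S × TwinFree S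

  -- canonical double cover D(Cay(G,S)) on G × {0,1} (false = 0, true = 1)
  DAdj : Subset → Carrier × Bool → Carrier × Bool → Set
  DAdj S (u , a) (v , b) = Adj S u v × a ≢ b

  Rd : Carrier → Carrier × Bool → Carrier × Bool
  Rd g (x , i) = (x ∙ g , i)

  -- β ∈ B(S): automorphism of D(Cay(G,S)) fixing G × {0} setwise
  InB : Subset → (Carrier × Bool) ↔ (Carrier × Bool) → Set
  InB S β =
    (∀ p q → DAdj S p q ⇔ DAdj S (to p) (to q)) ×
    (∀ p → (proj₂ (to p) ≡ false) ⇔ (proj₂ p ≡ false))
    where open Inverse β

  NormalisesR : (Carrier × Bool) ↔ (Carrier × Bool) → Set
  NormalisesR β =
    (∀ g → ∃[ h ] (∀ p → to (Rd g p) ≡ Rd h (to p))) ×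
    (∀ h → ∃[ g ] (∀ p → to (Rd g p) ≡ Rd h (to p)))
    where open Inverse β

  invPow : Bool → Carrier → Carrier
  invPow false x = x
  invPow true x = x ⁻¹

  -- β ∈ R(G) ⋊ ⟨ι⟩ (acting on G × {0,1} as (x,i) ↦ (x^α, i))
  InRι : (Carrier × Bool) ↔ (Carrier × Bool) → Set
  InRι β = ∃[ g ] ∃[ e ] (∀ x i → to (x , i) ≡ (invPow e x ∙ g , i))
    where open Inverse β

  -- 𝒮₃ : R(G) ⋊ ⟨ι⟩ is a proper subgroup of N_{B(S)}(R(G))
  -- (R(G)⋊⟨ι⟩ ≤ N_{B(S)}(R(G)) always holds for inverse-closed S in abelian G;
  --  properness = some element of the normaliser lies outside R(G)⋊⟨ι⟩)
  InS3 : Subset → Set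
  InS3 S = InS1 S ×
    Σ ((Carrier × Bool) ↔ (Carrier × Bool)) (λ β → InB S β × NormalisesR β × ¬ InRι β)

  IsAutomorphism : Carrier ↔ Carrier → Set
  IsAutomorphism φ = ∀ x y → to (x ∙ y) ≡ to x ∙ to y
    where open Inverse φ

  -- 𝒮₃' : S^α = S for some α = φ ∘ R(g) ∈ Hol(G) = R(G) ⋊ Aut(G), α ∉ {1, ι}.
  -- Since α is a bijection, S^α = S iff α⁻¹(S) = S, i.e. S (α x) = S x for all x.
  InS3' : Subset → Set
  InS3' S = InS1 S ×
    Σ (Carrier ↔ Carrier) λ φ → Σ Carrier λ g →
      let α : Carrier → Carrier
          α x = Inverse.to φ x ∙ g
      in IsAutomorphism φ ×
         ¬ (∀ x → α x ≡ x) ×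
         ¬ (∀ x → α x ≡ x ⁻¹) ×
         (∀ x → S (α x) ≡ S x)

{-# OPTIONS --safe #-}
module Submission where

-- An element β of B(S) keeps both layers G × {0} and G × {1}, so
-- β (x , i) = (σᵢ x , i) for two permutations σ₀, σ₁ of G. If β also
-- normalises R(G), say β R(g) β⁻¹ = R(H g), then σᵢ (x g) = σᵢ x · H g, which
-- forces H to be an automorphism and σᵢ x = σᵢ 1 · H x. Since β preserves the
-- edges (1 , 0) ~ (x , 1), the map α x = H x · σ₁ 1 · (σ₀ 1)⁻¹ of Hol(G)
-- fixes S; and α ∈ {1, ι} would give σ₀ 1 = σ₁ 1 and H ∈ {1, ι}, i.e.
-- β ∈ R(G) ⋊ ⟨ι⟩.

open import Defs
open import Level using (0ℓ)
open import Algebra.Bundles using (AbelianGroup)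
open import Data.Bool using (Bool; true; false)
open import Data.Bool.Properties using (⇔→≡)
open import Data.Product using (_×_; _,_; proj₁; proj₂)
open import Function.Bundles using (_↔_; _⇔_; Inverse; Equivalence; mk↔ₛ′; mk⇔)
open import Relation.Binary.PropositionalEquality

module LayerPreserving {A : Set} (β : (A × Bool) ↔ (A × Bool))
  (preserves : ∀ p → (proj₂ (Inverse.to β p) ≡ false) ⇔ (proj₂ p ≡ false)) where
  open Inverse β

  to-layer : ∀ p → proj₂ (to p) ≡ proj₂ p
  to-layer p = ⇔→≡ (preserves p)

  from-layer : ∀ p → proj₂ (from p) ≡ proj₂ p
  from-layer p = trans (sym (to-layer (from p))) (cong proj₂ (strictlyInverseˡ p))

  layer : Bool → A → A
  layer i x = proj₁ (to (x , i))

  layer⁻¹ : Bool → A → A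
  layer⁻¹ i z = proj₁ (from (z , i))

  to≡layer : ∀ x i → to (x , i) ≡ (layer i x , i)
  to≡layer x i = cong (layer i x ,_) (to-layer (x , i))

  from≡layer⁻¹ : ∀ z i → from (z , i) ≡ (layer⁻¹ i z , i)
  from≡layer⁻¹ z i = cong (layer⁻¹ i z ,_) (from-layer (z , i))

  layer-inverseˡ : ∀ i z → layer i (layer⁻¹ i z) ≡ z
  layer-inverseˡ i z = cong proj₁ (trans (cong to (sym (from≡layer⁻¹ z i))) (strictlyInverseˡ (z , i)))

  layer-inverseʳ : ∀ i x → layer⁻¹ i (layer i x) ≡ x
  layer-inverseʳ i x = cong proj₁ (trans (cong from (sym (to≡layer x i))) (strictlyInverseʳ (x , i)))

module _ (G : AbelianGroup 0ℓ 0ℓ) (≈⇒≡ : CayleyDefs.EqualityIsPropositional G) where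
  open AbelianGroup G using (Carrier; _∙_; ε; _⁻¹; reflexive; assoc; identityˡ; identityʳ; comm; group)
  open import Algebra.Properties.Group group using (∙-cancelˡ; ε⁻¹≈ε; x∙y⁻¹≈ε⇒x≈y)
  open CayleyDefs G
  open ≡-Reasoning

  ∙-assoc : ∀ x y z → (x ∙ y) ∙ z ≡ x ∙ (y ∙ z)
  ∙-assoc x y z = ≈⇒≡ _ _ (assoc x y z)

  ∙-identityˡ : ∀ x → ε ∙ x ≡ x
  ∙-identityˡ x = ≈⇒≡ _ _ (identityˡ x)

  ∙-identityʳ : ∀ x → x ∙ ε ≡ x
  ∙-identityʳ x = ≈⇒≡ _ _ (identityʳ x)

  ∙-comm : ∀ x y → x ∙ y ≡ y ∙ x
  ∙-comm x y = ≈⇒≡ _ _ (comm x y)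

  ∙-cancelˡ-≡ : ∀ a x y → a ∙ x ≡ a ∙ y → x ≡ y
  ∙-cancelˡ-≡ a x y eq = ≈⇒≡ _ _ (∙-cancelˡ a x y (reflexive eq))

  x∙ε⁻¹≡x : ∀ x → x ∙ ε ⁻¹ ≡ x
  x∙ε⁻¹≡x x = trans (cong (x ∙_) (≈⇒≡ _ _ ε⁻¹≈ε)) (∙-identityʳ x)

  invPow-ε : ∀ e → invPow e ε ≡ ε
  invPow-ε false = refl
  invPow-ε true  = ≈⇒≡ _ _ ε⁻¹≈ε

  Intertwines : (Carrier → Carrier) → (Carrier → Carrier) → Set
  Intertwines σ H = ∀ x g → σ (x ∙ g) ≡ σ x ∙ H g

  module _ {σ H : Carrier → Carrier} (σ-intertwines : Intertwines σ H) where

    intertwines⇒translate : ∀ x → σ x ≡ σ ε ∙ H x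
    intertwines⇒translate x = trans (cong σ (sym (∙-identityˡ x))) (σ-intertwines ε x)

    intertwines⇒homo : ∀ x y → H (x ∙ y) ≡ H x ∙ H y
    intertwines⇒homo x y = ∙-cancelˡ-≡ (σ ε) _ _ (begin
      σ ε ∙ H (x ∙ y)    ≡⟨ intertwines⇒translate (x ∙ y) ⟨
      σ (x ∙ y)          ≡⟨ σ-intertwines x y ⟩
      σ x ∙ H y          ≡⟨ cong (_∙ H y) (intertwines⇒translate x) ⟩
      (σ ε ∙ H x) ∙ H y  ≡⟨ ∙-assoc _ _ _ ⟩
      σ ε ∙ (H x ∙ H y)  ∎)

    intertwines⇒ε-homo : H ε ≡ ε
    intertwines⇒ε-homo = ∙-cancelˡ-≡ (σ ε) _ _
      (trans (sym (intertwines⇒translate ε)) (sym (∙-identityʳ (σ ε))))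

    intertwines⇒bijection : (σ⁻¹ : Carrier → Carrier) →
      (∀ z → σ (σ⁻¹ z) ≡ z) → (∀ x → σ⁻¹ (σ x) ≡ x) → Carrier ↔ Carrier
    intertwines⇒bijection σ⁻¹ inverseˡ inverseʳ = mk↔ₛ′ H (λ y → σ⁻¹ (σ ε ∙ y))
      (λ y → ∙-cancelˡ-≡ (σ ε) _ _
        (trans (sym (intertwines⇒translate _)) (inverseˡ (σ ε ∙ y))))
      (λ x → trans (cong σ⁻¹ (sym (intertwines⇒translate x))) (inverseʳ x))

  module NormalisingAutomorphism (S : Subset) (β : (Carrier × Bool) ↔ (Carrier × Bool))
    (β∈B : InB S β) (β-normalises : NormalisesR β) where
    open LayerPreserving β (proj₂ β∈B)

    H : Carrier → Carrier
    H g = proj₁ (proj₁ β-normalises g)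

    layer-intertwines : ∀ i → Intertwines (layer i) H
    layer-intertwines i x g = cong proj₁ (proj₂ (proj₁ β-normalises g) (x , i))

    H-homo : ∀ x y → H (x ∙ y) ≡ H x ∙ H y
    H-homo = intertwines⇒homo (layer-intertwines true)

    H-bijection : Carrier ↔ Carrier
    H-bijection = intertwines⇒bijection (layer-intertwines true)
      (layer⁻¹ true) (layer-inverseˡ true) (layer-inverseʳ true)

    shift : Carrier
    shift = layer true ε ∙ layer false ε ⁻¹

    α : Carrier → Carrier
    α x = H x ∙ shift

    layer-true-shifted≡α : ∀ x → layer true x ∙ layer false ε ⁻¹ ≡ α x
    layer-true-shifted≡α x = begin
      layer true x ∙ layer false ε ⁻¹             ≡⟨ cong (_∙ layer false ε ⁻¹) (intertwines⇒translate (layer-intertwines true) x) ⟩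
      (layer true ε ∙ H x) ∙ layer false ε ⁻¹     ≡⟨ cong (_∙ layer false ε ⁻¹) (∙-comm _ _) ⟩
      (H x ∙ layer true ε) ∙ layer false ε ⁻¹     ≡⟨ ∙-assoc _ _ _ ⟩
      α x                                         ∎

    adjacent-across : ∀ x → Adj S ε x ⇔ Adj S (layer false ε) (layer true x)
    adjacent-across x = mk⇔
      (λ adj → proj₁ (Equivalence.to (proj₁ β∈B (ε , false) (x , true)) (adj , λ ())))
      (λ adj → proj₁ (Equivalence.from (proj₁ β∈B (ε , false) (x , true)) (adj , layers-differ)))
      where
      layers-differ : proj₂ (Inverse.to β (ε , false)) ≢ proj₂ (Inverse.to β (x , true))
      layers-differ eq with () ← trans (sym (to-layer (ε , false))) (trans eq (to-layer (x , true)))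

    S-α-invariant : ∀ x → S (α x) ≡ S x
    S-α-invariant x = begin
      S (α x)                                  ≡⟨ cong S (layer-true-shifted≡α x) ⟨
      S (layer true x ∙ layer false ε ⁻¹)      ≡⟨ ⇔→≡ (adjacent-across x) ⟨
      S (x ∙ ε ⁻¹)                             ≡⟨ cong S (x∙ε⁻¹≡x x) ⟩
      S x                                      ∎

    α≡invPow⇒InRι : ∀ e → (∀ x → α x ≡ invPow e x) → InRι β
    α≡invPow⇒InRι e α≡ = layer false ε , e , λ x i → begin
      Inverse.to β (x , i)             ≡⟨ to≡layer x i ⟩
      (layer i x , i)                  ≡⟨ cong (_, i) (intertwines⇒translate (layer-intertwines i) x) ⟩
      (layer i ε ∙ H x , i)            ≡⟨ cong₂ (λ u v → (u ∙ v , i)) (layer-ε i) (H≡invPow x) ⟩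
      (layer false ε ∙ invPow e x , i) ≡⟨ cong (_, i) (∙-comm _ _) ⟩
      (invPow e x ∙ layer false ε , i) ∎
      where
      shift≡ε : shift ≡ ε
      shift≡ε = begin
        shift          ≡⟨ ∙-identityˡ shift ⟨
        ε ∙ shift      ≡⟨ cong (_∙ shift) (intertwines⇒ε-homo (layer-intertwines true)) ⟨
        α ε            ≡⟨ α≡ ε ⟩
        invPow e ε     ≡⟨ invPow-ε e ⟩
        ε              ∎

      layer-ε : ∀ i → layer i ε ≡ layer false ε
      layer-ε false = refl
      layer-ε true  = ≈⇒≡ _ _ (x∙y⁻¹≈ε⇒x≈y _ _ (reflexive shift≡ε))

      H≡invPow : ∀ x → H x ≡ invPow e x
      H≡invPow x = begin
        H x          ≡⟨ ∙-identityʳ (H x) ⟨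
        H x ∙ ε      ≡⟨ cong (H x ∙_) shift≡ε ⟨
        α x          ≡⟨ α≡ x ⟩
        invPow e x   ∎

lemma3p6 : (G : AbelianGroup 0ℓ 0ℓ) →
    CayleyDefs.EqualityIsPropositional G →
    CayleyDefs.IsFinite G →
    CayleyDefs.ExponentGreaterThan2 G →
    (S : CayleyDefs.Subset G) →
    CayleyDefs.InS3 G S → CayleyDefs.InS3' G S
lemma3p6 G ≈⇒≡ _ _ S (S∈S₁ , β , β∈B , β-normalises , β∉Rι) =
  S∈S₁ , H-bijection , shift , H-homo ,
  (λ α≡id → β∉Rι (α≡invPow⇒InRι false α≡id)) ,
  (λ α≡ι → β∉Rι (α≡invPow⇒InRι true α≡ι)) ,
  S-α-invariant
  where open NormalisingAutomorphism G ≈⇒≡ S β β∈B β-normalises
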